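{- Let $G$ be a finite group, $H$ a subgroup, and $S\subset G$ a nonempty subset with $S\cap H$ symmetric; let $S_O=S\setminus H$. Then $0$ is an eigenvalue of $\mathcal{G}(G,H,S)$ of multiplicity at least \[|G|-|H|-\min\Big(\Big|\bigcup_{s\in S_O}Hs\Big|,\ |H|\Big).\]
   Context: A subset $X\subset G$ is symmetric if $X^{ -1}=X$. The group-subgroup pair graph $\mathcal{G}(G,H,S)$ is the undirected graph with vertex set $G$ whose edges are exactly the pairs $\{h,hs\}$ with $h\in H$, $s\in S$; its eigenvalues (with multiplicity) are those of its adjacency matrix. -}

module Defs where

open import Data.Nat using (ℕ; zero; suc)
open import Data.Fin using (Fin; zero; suc; _≟_)
open import Data.Fin.Properties using (any?)
open import Data.Fin.Subset using (Subset; _∈_; _∉_)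
open import Data.Fin.Subset.Properties using (_∈?_)
open import Data.Bool using (Bool)
open import Data.Product using (Σ; Σ-syntax; ∃; _×_; _,_)
open import Data.Sum using (_⊎_)
open import Data.Vec using (tabulate)
open import Data.Rational using (ℚ; 0ℚ; 1ℚ; _+_; _*_; _-_)
open import Relation.Binary.PropositionalEquality using (_≡_)
open import Relation.Nullary using (¬_; Dec; yes; no)
open import Relation.Nullary.Decidable using (⌊_⌋; _×-dec_; _⊎-dec_; ¬?)
open import Algebra.Structures using (IsGroup)

-- A finite group of order n, with elements labelled by Fin n
-- (every finite group is isomorphic to one of this form).
record FinGroup (n : ℕ) : Set where
  infixl 7 _∙_
  field
    _∙_     : Fin n → Fin n → Fin n
    ε       : Fin n
    _⁻¹     : Fin n → Fin n
    isGroup : IsGroup _≡_ _∙_ ε _⁻¹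

module _ {n : ℕ} (G : FinGroup n) where
  open FinGroup G

  IsSubgroup : Subset n → Set
  IsSubgroup H = (ε ∈ H)
               × (∀ x y → x ∈ H → y ∈ H → (x ∙ y) ∈ H)
               × (∀ x → x ∈ H → (x ⁻¹) ∈ H)

  -- S ∩ H is symmetric: (S ∩ H)⁻¹ = S ∩ H  (the inclusion ⊆ suffices, as ⁻¹ is an involution)
  SymmetricOn : Subset n → Subset n → Set
  SymmetricOn S H = ∀ x → x ∈ S → x ∈ H → ((x ⁻¹) ∈ S × (x ⁻¹) ∈ H)

  unionCosetsO : Subset n → Subset n → Subset n
  unionCosetsO H S = tabulate λ g →
    ⌊ any? (λ h → any? (λ s →
         (h ∈? H) ×-dec ((s ∈? S) ×-dec (¬? (s ∈? H) ×-dec (g ≟ h ∙ s))))) ⌋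

  Edge : Subset n → Subset n → Fin n → Fin n → Set
  Edge H S x y = ∃ λ h → ∃ λ s → h ∈ H × s ∈ S ×
                   ((x ≡ h × y ≡ h ∙ s) ⊎ (y ≡ h × x ≡ h ∙ s))

  edge? : ∀ H S x y → Dec (Edge H S x y)
  edge? H S x y = any? (λ h → any? (λ s →
     (h ∈? H) ×-dec ((s ∈? S) ×-dec
       (((x ≟ h) ×-dec (y ≟ h ∙ s)) ⊎-dec ((y ≟ h) ×-dec (x ≟ h ∙ s))))))

  adjacency : Subset n → Subset n → Fin n → Fin n → ℚ
  adjacency H S x y with edge? H S x y
  ... | yes _ = 1ℚ
  ... | no  _ = 0ℚ

Σℚ : ∀ {m} → (Fin m → ℚ) → ℚ
Σℚ {zero}  f = 0ℚ
Σℚ {suc m} f = f zero + Σℚ (λ i → f (suc i))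

IsEigenvector : ∀ {n} → (Fin n → Fin n → ℚ) → ℚ → (Fin n → ℚ) → Set
IsEigenvector A λ' v = ∀ x → Σℚ (λ y → A x y * v y) ≡ λ' * v x

LinearlyIndependent : ∀ {k n} → (Fin k → Fin n → ℚ) → Set
LinearlyIndependent {k} {n} v =
  (c : Fin k → ℚ) → (∀ x → Σℚ (λ i → c i * v i x) ≡ 0ℚ) → ∀ i → c i ≡ 0ℚ

-- λ is an eigenvalue of the (symmetric) matrix A of multiplicity at least m:
-- the λ-eigenspace has dimension ≥ m, i.e. contains m linearly independent vectors.
EigenvalueMultiplicity≥ : ∀ {n} → (Fin n → Fin n → ℚ) → ℚ → ℕ → Set
EigenvalueMultiplicity≥ {n} A λ' m =
  Σ[ v ∈ (Fin m → Fin n → ℚ) ] (LinearlyIndependent v × (∀ i → IsEigenvector A λ' (v i)))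

-- Every edge {h, h s} of 𝒢(G,H,S) has an endpoint in H, and its other endpoint h s
-- lies in H (if s ∈ H) or in U = ⋃_{s ∈ S ∖ H} H s.  Hence a vector v on G is in
-- the kernel of the adjacency matrix A as soon as
--   (a) v vanishes on H and the |H| rows of A indexed by H annihilate v, or
--   (b) v vanishes on H ∪ U.
-- These are homogeneous linear systems of 2|H|, resp. |H| + |U|, equations in |G|
-- unknowns, and Gaussian elimination yields |G| minus that many independent solutions.
module Submission where

open import Defs
open import Data.Nat as ℕ using (ℕ; zero; suc; _∸_; _⊓_; _≤?_)
import Data.Nat.Properties as ℕ
open import Data.Fin using (Fin; zero; suc)
open import Data.Fin.Subset using (Subset; Nonempty; ∣_∣; _∈_; _∉_)
open import Data.Fin.Subset.Properties using (_∈?_)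
open import Data.Bool using (true; false)
open import Data.Vec using ([]; _∷_; here; there)
open import Data.Vec.Properties using (lookup⇒[]=; lookup∘tabulate)
open import Data.Vec.Functional using (tail) renaming (_∷_ to _∷ᶠ_)
open import Data.List using (List; []; _∷_; length; map; _++_; [_])
open import Data.List.Properties using (length-map; length-++)
open import Data.List.Membership.Propositional using (find)
open import Data.List.Membership.Propositional.Properties using (∈-∃++)
open import Data.List.Relation.Unary.All as All using (All; _∷_; all?)
open import Data.List.Relation.Unary.All.Properties using (map⁻; ++⁻ˡ; ++⁻ʳ; ¬All⇒Any¬)
open import Data.List.Relation.Binary.Permutation.Propositional using (_↭_; ↭-sym)
open import Data.List.Relation.Binary.Permutation.Propositional.Properties
  using (All-resp-↭; ↭-length; shift)
open import Data.Rational using (ℚ; 0ℚ; 1ℚ; _+_; _*_; _-_; -_; 1/_; NonZero; ≢-nonZero)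
open import Data.Rational.Properties
  using (_≟_; *-comm; *-zeroˡ; *-zeroʳ; +-identityˡ; +-identityʳ; *-identityˡ; *-identityʳ; *-inverseʳ)
open import Data.Rational.Solver using (module +-*-Solver)
open import Data.Product using (Σ-syntax; _×_; _,_; proj₁; proj₂)
open import Data.Empty using (⊥-elim)
open import Data.Sum using (_⊎_; inj₁; inj₂)
open import Function using (_∘_)
open import Relation.Binary.PropositionalEquality using (_≡_; refl; sym; trans; cong; cong₂; subst; module ≡-Reasoning)
open import Relation.Nullary using (Dec; yes; no)
open import Relation.Nullary.Decidable using (_×-dec_; ¬?; dec-true; isYes≗does)
open import Data.Fin.Properties using (any?) renaming (_≟_ to _≟ᶠ_)

open +-*-Solver using (solve; _:=_; _:+_; _:-_; _:*_; :-_; con)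

dot : ∀ {N} → (Fin N → ℚ) → (Fin N → ℚ) → ℚ
dot f v = Σℚ (λ y → f y * v y)

Σℚ-cong : ∀ {m} {f g : Fin m → ℚ} → (∀ i → f i ≡ g i) → Σℚ f ≡ Σℚ g
Σℚ-cong {zero}  f≡g = refl
Σℚ-cong {suc m} f≡g = cong₂ _+_ (f≡g zero) (Σℚ-cong (f≡g ∘ suc))

Σℚ-zero : ∀ {m} (f : Fin m → ℚ) → (∀ i → f i ≡ 0ℚ) → Σℚ f ≡ 0ℚ
Σℚ-zero {zero}  f f≡0 = refl
Σℚ-zero {suc m} f f≡0 =
  trans (cong₂ _+_ (f≡0 zero) (Σℚ-zero (tail f) (f≡0 ∘ suc))) (+-identityˡ 0ℚ)

dot-comm : ∀ {N} (f v : Fin N → ℚ) → dot f v ≡ dot v f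
dot-comm f v = Σℚ-cong (λ y → *-comm (f y) (v y))

dot-zeroʳ : ∀ {N} (f : Fin N → ℚ) → dot f (λ _ → 0ℚ) ≡ 0ℚ
dot-zeroʳ f = Σℚ-zero _ (λ y → *-zeroʳ (f y))

dot-0∷ : ∀ {N} (f : Fin (suc N) → ℚ) (w : Fin N → ℚ) → dot f (0ℚ ∷ᶠ w) ≡ dot (tail f) w
dot-0∷ f w = trans (cong (_+ dot (tail f) w) (*-zeroʳ (f zero))) (+-identityˡ _)

dot-linearˡ : ∀ {N} (a b w : Fin N → ℚ) (c : ℚ) →
              dot (λ y → a y - c * b y) w ≡ dot a w - c * dot b w
dot-linearˡ {zero}  a b w c = solve 1 (λ c → con 0ℚ := con 0ℚ :- c :* con 0ℚ) refl c
dot-linearˡ {suc N} a b w c = begin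
  (a zero - c * b zero) * w zero + dot (λ y → tail a y - c * tail b y) (tail w)
    ≡⟨ cong ((a zero - c * b zero) * w zero +_) (dot-linearˡ (tail a) (tail b) (tail w) c) ⟩
  (a zero - c * b zero) * w zero + (dot (tail a) (tail w) - c * dot (tail b) (tail w))
    ≡⟨ solve 6 (λ a₀ b₀ w₀ c A B → (a₀ :- c :* b₀) :* w₀ :+ (A :- c :* B)
                                   := a₀ :* w₀ :+ A :- c :* (b₀ :* w₀ :+ B))
             refl (a zero) (b zero) (w zero) c (dot (tail a) (tail w)) (dot (tail b) (tail w)) ⟩
  dot a w - c * dot b w ∎
  where open ≡-Reasoning

unitVector : ∀ {N} → Fin N → Fin N → ℚ
unitVector zero    = 1ℚ ∷ᶠ λ _ → 0ℚ
unitVector (suc i) = 0ℚ ∷ᶠ unitVector i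

dot-unitVector : ∀ {N} (f : Fin N → ℚ) i → dot f (unitVector i) ≡ f i
dot-unitVector f zero    = trans (cong₂ _+_ (*-identityʳ (f zero)) (dot-zeroʳ (tail f))) (+-identityʳ _)
dot-unitVector f (suc i) = trans (dot-0∷ f (unitVector i)) (dot-unitVector (tail f) i)

Solves : ∀ {N} → List (Fin N → ℚ) → (Fin N → ℚ) → Set
Solves eqs v = All (λ f → dot f v ≡ 0ℚ) eqs

record IndependentSolutions (N m : ℕ) (eqs : List (Fin N → ℚ)) : Set where
  field
    solution    : Fin m → Fin N → ℚ
    independent : LinearlyIndependent solution
    solves      : ∀ i → Solves eqs (solution i)
open IndependentSolutions

noIndependentSolutions : ∀ {N eqs} → IndependentSolutions N 0 eqs
noIndependentSolutions = record { solution = λ () ; independent = λ _ _ () ; solves = λ () }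

IndependentSolutions-resp-↭ : ∀ {N m eqs eqs′} → eqs ↭ eqs′ →
                              IndependentSolutions N m eqs → IndependentSolutions N m eqs′
IndependentSolutions-resp-↭ eqs↭eqs′ K = record
  { solution = solution K ; independent = independent K ; solves = All-resp-↭ eqs↭eqs′ ∘ solves K }

independent-if-tails-independent : ∀ {m N} (v : Fin m → Fin (suc N) → ℚ) →
                                   LinearlyIndependent (tail ∘ v) → LinearlyIndependent v
independent-if-tails-independent v tails-independent c vanishes =
  tails-independent c (vanishes ∘ suc)

freeFirstVariable : ∀ {N m} {eqs : List (Fin (suc N) → ℚ)} → All (λ g → g zero ≡ 0ℚ) eqs →
                    IndependentSolutions N m (map tail eqs) →
                    IndependentSolutions (suc N) (suc m) eqs
freeFirstVariable {N} {m} {eqs} g₀≡0 K =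
  record { solution = v ; independent = v-independent ; solves = v-solves }
  where
  v : Fin (suc m) → Fin (suc N) → ℚ
  v zero    = unitVector zero
  v (suc i) = 0ℚ ∷ᶠ solution K i

  v-independent : LinearlyIndependent v
  v-independent c vanishes zero    = trans (sym (dot-unitVector c zero)) (vanishes zero)
  v-independent c vanishes (suc i) = independent K (tail c)
    (λ y → trans (sym (dot-0∷ c (λ j → solution K j y))) (vanishes (suc y))) i

  v-solves : ∀ i → Solves eqs (v i)
  v-solves zero    = All.map (λ {g} g₀≡0 → trans (dot-unitVector g zero) g₀≡0) g₀≡0
  v-solves (suc i) = All.map (λ {g} → trans (dot-0∷ g (solution K i))) (map⁻ (solves K i))

module _ {N} (f : Fin (suc N) → ℚ) .{{_ : NonZero (f zero)}} where

  eliminateWith : (Fin (suc N) → ℚ) → Fin N → ℚ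
  eliminateWith g y = tail g y - (g zero * 1/ f zero) * tail f y

  -- A solution w of the reduced system extends to (− tail f · w / f₀) ∷ w, which solves f
  -- and every g; independence is inherited from the tails.
  eliminateFirstVariable : ∀ {m eqs} → IndependentSolutions N m (map eliminateWith eqs) →
                           IndependentSolutions (suc N) m (f ∷ eqs)
  eliminateFirstVariable {m} K =
    record { solution = v ; independent = independent-if-tails-independent v (independent K)
           ; solves = λ i → f-solved i ∷ All.map (λ {g} → g-solved i g) (map⁻ (solves K i)) }
    where
    F : Fin m → ℚ
    F i = dot (tail f) (solution K i)

    v : Fin m → Fin (suc N) → ℚ
    v i = (- F i * 1/ f zero) ∷ᶠ solution K i

    f-solved : ∀ i → dot f (v i) ≡ 0ℚ
    f-solved i = begin
      f zero * (- F i * 1/ f zero) + F i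
        ≡⟨ solve 3 (λ f₀ F f₀⁻¹ → f₀ :* (:- F :* f₀⁻¹) :+ F := F :- (f₀ :* f₀⁻¹) :* F)
                 refl (f zero) (F i) (1/ f zero) ⟩
      F i - (f zero * 1/ f zero) * F i
        ≡⟨ cong (λ t → F i - t * F i) (*-inverseʳ (f zero)) ⟩
      F i - 1ℚ * F i
        ≡⟨ solve 1 (λ F → F :- con 1ℚ :* F := con 0ℚ) refl (F i) ⟩
      0ℚ ∎
      where open ≡-Reasoning

    g-solved : ∀ i g → dot (eliminateWith g) (solution K i) ≡ 0ℚ → dot g (v i) ≡ 0ℚ
    g-solved i g eliminated-solved = begin
      g zero * (- F i * 1/ f zero) + dot (tail g) (solution K i)
        ≡⟨ solve 4 (λ g₀ F f₀⁻¹ T → g₀ :* (:- F :* f₀⁻¹) :+ T := T :- (g₀ :* f₀⁻¹) :* F)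
                 refl (g zero) (F i) (1/ f zero) (dot (tail g) (solution K i)) ⟩
      dot (tail g) (solution K i) - (g zero * 1/ f zero) * F i
        ≡⟨ sym (dot-linearˡ (tail g) (tail f) (solution K i) (g zero * 1/ f zero)) ⟩
      dot (eliminateWith g) (solution K i)
        ≡⟨ eliminated-solved ⟩
      0ℚ ∎
      where open ≡-Reasoning

independentSolutions : ∀ N (eqs : List (Fin N → ℚ)) → IndependentSolutions N (N ∸ length eqs) eqs
independentSolutions zero eqs rewrite ℕ.0∸n≡0 (length eqs) = noIndependentSolutions
independentSolutions (suc N) eqs with all? (λ g → g zero ≟ 0ℚ) eqs
... | yes g₀≡0 with length eqs ≤? N
...   | yes k≤N = subst (λ m → IndependentSolutions (suc N) m eqs)
                    (sym (ℕ.+-∸-assoc 1 k≤N))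
                    (freeFirstVariable g₀≡0
                      (subst (λ k → IndependentSolutions N (N ∸ k) (map tail eqs))
                        (length-map tail eqs) (independentSolutions N (map tail eqs))))
...   | no k≰N = subst (λ m → IndependentSolutions (suc N) m eqs)
                   (sym (ℕ.m≤n⇒m∸n≡0 (ℕ.≰⇒> k≰N))) noIndependentSolutions
independentSolutions (suc N) eqs | no ¬g₀≡0
  with f , f∈eqs , f₀≢0 ← find (¬All⇒Any¬ (λ g → g zero ≟ 0ℚ) eqs ¬g₀≡0)
  with pre , post , refl ← ∈-∃++ f∈eqs =
  subst (λ m → IndependentSolutions (suc N) m (pre ++ [ f ] ++ post)) counts-agree
    (IndependentSolutions-resp-↭ (↭-sym (shift f pre post))
      (eliminateFirstVariable f (independentSolutions N (map (eliminateWith f) (pre ++ post)))))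
  where
  instance
    f₀-nonZero : NonZero (f zero)
    f₀-nonZero = ≢-nonZero f₀≢0
  counts-agree : N ∸ length (map (eliminateWith f) (pre ++ post)) ≡ suc N ∸ length (pre ++ [ f ] ++ post)
  counts-agree = trans (cong (N ∸_) (length-map (eliminateWith f) (pre ++ post)))
                (cong (suc N ∸_) (sym (↭-length (shift f pre post))))

multiplicity≥-from-solutions : ∀ {N} (A : Fin N → Fin N → ℚ) (eqs : List (Fin N → ℚ)) →
                               (∀ {v} → Solves eqs v → IsEigenvector A 0ℚ v) →
                               EigenvalueMultiplicity≥ A 0ℚ (N ∸ length eqs)
multiplicity≥-from-solutions {N} A eqs in-kernel =
  solution K , independent K , in-kernel ∘ solves K
  where
  K : IndependentSolutions N (N ∸ length eqs) eqs
  K = independentSolutions N eqs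

kernel-vector : ∀ {N} (A : Fin N → Fin N → ℚ) {v} → (∀ x → dot (A x) v ≡ 0ℚ) → IsEigenvector A 0ℚ v
kernel-vector A {v} rows-vanish x = trans (rows-vanish x) (sym (*-zeroˡ (v x)))

elements : ∀ {n} → Subset n → List (Fin n)
elements []          = []
elements (true ∷ p)  = zero ∷ map suc (elements p)
elements (false ∷ p) = map suc (elements p)

length-elements : ∀ {n} (p : Subset n) → length (elements p) ≡ ∣ p ∣
length-elements []          = refl
length-elements (true ∷ p)  = cong suc (trans (length-map suc (elements p)) (length-elements p))
length-elements (false ∷ p) = trans (length-map suc (elements p)) (length-elements p)

All-elements⇒∈ : ∀ {n} {P : Fin n → Set} (p : Subset n) → All P (elements p) → ∀ {x} → x ∈ p → P x
All-elements⇒∈ (true ∷ p)  (Px ∷ _)  here        = Px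
All-elements⇒∈ (true ∷ p)  (_ ∷ Pps) (there x∈p) = All-elements⇒∈ p (map⁻ Pps) x∈p
All-elements⇒∈ (false ∷ p) Pps       (there x∈p) = All-elements⇒∈ p (map⁻ Pps) x∈p

∸-length-map-elements-++ : ∀ {n N} {A : Set} (f g : Fin n → A) (P Q : Subset n) →
                           N ∸ length (map f (elements P) ++ map g (elements Q)) ≡ N ∸ ∣ P ∣ ∸ ∣ Q ∣
∸-length-map-elements-++ {N = N} f g P Q = begin
  N ∸ length (map f (elements P) ++ map g (elements Q))
    ≡⟨ cong (N ∸_) (length-++ (map f (elements P))) ⟩
  N ∸ (length (map f (elements P)) ℕ.+ length (map g (elements Q)))
    ≡⟨ cong₂ (λ a b → N ∸ (a ℕ.+ b)) (length-map f (elements P)) (length-map g (elements Q)) ⟩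
  N ∸ (length (elements P) ℕ.+ length (elements Q))
    ≡⟨ cong₂ (λ a b → N ∸ (a ℕ.+ b)) (length-elements P) (length-elements Q) ⟩
  N ∸ (∣ P ∣ ℕ.+ ∣ Q ∣)
    ≡⟨ sym (ℕ.∸-+-assoc N ∣ P ∣ ∣ Q ∣) ⟩
  N ∸ ∣ P ∣ ∸ ∣ Q ∣ ∎
  where open ≡-Reasoning

vanishesOn : ∀ {n} → Subset n → List (Fin n → ℚ)
vanishesOn P = map unitVector (elements P)

Solves-vanishesOn : ∀ {n} (P : Subset n) {v} → Solves (vanishesOn P) v → ∀ {x} → x ∈ P → v x ≡ 0ℚ
Solves-vanishesOn P {v} solved x∈P =
  trans (sym (trans (dot-comm _ v) (dot-unitVector v _))) (All-elements⇒∈ P (map⁻ solved) x∈P)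

module _ {n} (G : FinGroup n) (H S : Subset n) (H≤G : IsSubgroup G H) where
  open FinGroup G

  private
    A : Fin n → Fin n → ℚ
    A = adjacency G H S

    U : Subset n
    U = unionCosetsO G H S

  ∙-∈unionCosetsO : ∀ {h s} → h ∈ H → s ∈ S → s ∉ H → h ∙ s ∈ U
  ∙-∈unionCosetsO {h} {s} h∈H s∈S s∉H = lookup⇒[]= (h ∙ s) U
    (trans (lookup∘tabulate _ (h ∙ s))
      (trans (isYes≗does h∙s∈U?) (dec-true h∙s∈U? (h , s , h∈H , s∈S , s∉H , refl))))
    where
    h∙s∈U? : Dec (Σ[ h′ ∈ Fin n ] Σ[ s′ ∈ Fin n ] (h′ ∈ H × s′ ∈ S × s′ ∉ H × h ∙ s ≡ h′ ∙ s′))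
    h∙s∈U? = any? (λ h′ → any? (λ s′ →
               (h′ ∈? H) ×-dec ((s′ ∈? S) ×-dec (¬? (s′ ∈? H) ×-dec ((h ∙ s) ≟ᶠ h′ ∙ s′)))))

  Edge-from-outside-H : ∀ {x y} → x ∉ H → Edge G H S x y → y ∈ H
  Edge-from-outside-H x∉H (_ , _ , h∈H , _ , inj₁ (refl , _)) = ⊥-elim (x∉H h∈H)
  Edge-from-outside-H x∉H (_ , _ , h∈H , _ , inj₂ (refl , _)) = h∈H

  Edge-target : ∀ {x y} → Edge G H S x y → y ∈ H ⊎ y ∈ U
  Edge-target (_ , _ , h∈H , _ , inj₂ (refl , _)) = inj₁ h∈H
  Edge-target (h , s , h∈H , s∈S , inj₁ (_ , refl)) with s ∈? H
  ... | yes s∈H = inj₁ (proj₁ (proj₂ H≤G) h s h∈H s∈H)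
  ... | no  s∉H = inj₂ (∙-∈unionCosetsO h∈H s∈S s∉H)

  dot-row≡0 : ∀ x {v} → (∀ {y} → Edge G H S x y → v y ≡ 0ℚ) → dot (A x) v ≡ 0ℚ
  dot-row≡0 x {v} vanishes-on-neighbours = Σℚ-zero _ term
    where
    term : ∀ y → A x y * v y ≡ 0ℚ
    term y with edge? G H S x y
    ... | yes e = trans (*-identityˡ (v y)) (vanishes-on-neighbours e)
    ... | no  _ = *-zeroˡ (v y)

  kernel-via-rows : ∀ {v} → Solves (vanishesOn H ++ map A (elements H)) v → IsEigenvector A 0ℚ v
  kernel-via-rows {v} solved = kernel-vector A row
    where
    row : ∀ x → dot (A x) v ≡ 0ℚ
    row x with x ∈? H
    ... | yes x∈H = All-elements⇒∈ H (map⁻ (++⁻ʳ (vanishesOn H) solved)) x∈H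
    ... | no  x∉H = dot-row≡0 x (Solves-vanishesOn H (++⁻ˡ (vanishesOn H) solved) ∘ Edge-from-outside-H x∉H)

  kernel-via-cosets : ∀ {v} → Solves (vanishesOn H ++ vanishesOn U) v → IsEigenvector A 0ℚ v
  kernel-via-cosets {v} solved = kernel-vector A (λ x → dot-row≡0 x (vanishes-on-H∪U ∘ Edge-target))
    where
    vanishes-on-H∪U : ∀ {y} → y ∈ H ⊎ y ∈ U → v y ≡ 0ℚ
    vanishes-on-H∪U (inj₁ y∈H) = Solves-vanishesOn H (++⁻ˡ (vanishesOn H) solved) y∈H
    vanishes-on-H∪U (inj₂ y∈U) = Solves-vanishesOn U (++⁻ʳ (vanishesOn H) solved) y∈U

  multiplicity≥-via-rows : EigenvalueMultiplicity≥ A 0ℚ (n ∸ ∣ H ∣ ∸ ∣ H ∣)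
  multiplicity≥-via-rows =
    subst (EigenvalueMultiplicity≥ A 0ℚ) (∸-length-map-elements-++ unitVector A H H)
      (multiplicity≥-from-solutions A _ kernel-via-rows)

  multiplicity≥-via-cosets : EigenvalueMultiplicity≥ A 0ℚ (n ∸ ∣ H ∣ ∸ ∣ U ∣)
  multiplicity≥-via-cosets =
    subst (EigenvalueMultiplicity≥ A 0ℚ) (∸-length-map-elements-++ unitVector unitVector H U)
      (multiplicity≥-from-solutions A _ kernel-via-cosets)

proposition3p13 : (n : ℕ) (G : FinGroup n) (H S : Subset n)
    → IsSubgroup G H
    → Nonempty S
    → SymmetricOn G S H
    → EigenvalueMultiplicity≥ (adjacency G H S) 0ℚ
        (n ∸ ∣ H ∣ ∸ (∣ unionCosetsO G H S ∣ ⊓ ∣ H ∣))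
proposition3p13 n G H S H≤G _ _ with ℕ.≤-total ∣ H ∣ ∣ unionCosetsO G H S ∣
... | inj₁ H≤U rewrite ℕ.m≥n⇒m⊓n≡n H≤U = multiplicity≥-via-rows G H S H≤G
... | inj₂ U≤H rewrite ℕ.m≤n⇒m⊓n≡m U≤H = multiplicity≥-via-cosets G H S H≤G
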